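{- Let $({\cal F},\tau)$ be an oriented Fano plane, let $\epsilon^\tau$ be its canonical composition factor, and let $g\in\mathrm{Aut}({\cal F})$. Then the function $\delta^\ast(g,\cdot):{\cal F}^\ast\to S_2$ (computed with $\epsilon=\epsilon^\tau$) is one of the following eight functions: the constant function $1$, or, for some point $P\in{\cal F}$, the function $D\mapsto 1$ if $P\in D$ and $D\mapsto-1$ if $P\notin D$.
   Context: A Fano plane ${\cal F}$ is a projective plane with seven points and seven lines; ${\cal F}^\ast$ is its set of lines; $\mathrm{Aut}({\cal F})$ is the group of bijections of ${\cal F}$ sending lines to lines. $S_2=\{1,-1\}$. An orientation of ${\cal F}$ is an element $\tau\in\mathrm{Aut}({\cal F})$ of order seven. The canonical composition factor $\epsilon^\tau$ is defined on ordered pairs of distinct points: fix $P_0\in{\cal F}$, write $R=\tau^i(P_0)$, $S=\tau^j(P_0)$; then $\epsilon^\tau_{RS}=1$ if $j-i\equiv1,2,4 \pmod 7$ and $\epsilon^\tau_{RS}=-1$ if $j-i\equiv 3,5,6\pmod 7$ (this is independent of $P_0$ and is a composition factor, i.e. the corresponding algebra on $\mathbb F 1\oplus\bigoplus_P\mathbb F e_P$ with $e_Pe_Q=\epsilon_{PQ}e_{P+Q}$, $e_P^2=-1$, $1$ a unit, is a composition algebra for the sum-of-squares norm). For a composition factor $\epsilon$, $g\in\mathrm{Aut}({\cal F})$ and a line $D$, $\delta^\ast(g,D)=\epsilon_{PQ}\,\epsilon_{g(P)\,g(Q)}$ for any two distinct points $P,Q\in D$ (this does not depend on the choice of $P,Q$).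 -}

module Defs where

open import Data.Nat using (ℕ; zero; suc; _≤_; _<_)
open import Data.Fin using (Fin; toℕ)
open import Data.Fin.Properties using ()
open import Data.Nat.DivMod using (_%_)
open import Data.Nat using (_+_; _∸_)
open import Data.Product using (Σ; Σ-syntax; ∃; _×_; _,_)
open import Data.Sign using (Sign) renaming (_*_ to _·_)
import Data.Sign as Sgn
open import Data.Sum using (_⊎_)
open import Function using (_∘_; _⇔_)
open import Function.Bundles using (_↔_; Inverse)
open import Relation.Binary.PropositionalEquality using (_≡_; _≢_)
open import Relation.Nullary using (¬_)

-- S₂ = {1, -1}, realised as the standard-library Sign (+ = 1, - = -1)
S₂ : Set
S₂ = Sign

iter : {A : Set} → ℕ → (A → A) → A → A
iter zero    f x = x
iter (suc n) f x = f (iter n f x)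

record FanoPlane : Set₁ where
  field
    Point  : Set
    Line   : Set
    _∈_    : Point → Line → Set
    points : Fin 7 ↔ Point
    lines  : Fin 7 ↔ Line
    join   : ∀ (P Q : Point) → P ≢ Q →
             Σ[ D ∈ Line ] (P ∈ D × Q ∈ D × (∀ E → P ∈ E → Q ∈ E → E ≡ D))
    meet   : ∀ (D E : Line) → D ≢ E →
             Σ[ P ∈ Point ] (P ∈ D × P ∈ E × (∀ Q → Q ∈ D → Q ∈ E → Q ≡ P))
    nondeg : Σ[ A ∈ Point ] Σ[ B ∈ Point ] Σ[ C ∈ Point ] Σ[ D ∈ Point ]
             (A ≢ B × A ≢ C × A ≢ D × B ≢ C × B ≢ D × C ≢ D ×
              (∀ L → ¬ (A ∈ L × B ∈ L × C ∈ L)) ×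
              (∀ L → ¬ (A ∈ L × B ∈ L × D ∈ L)) ×
              (∀ L → ¬ (A ∈ L × C ∈ L × D ∈ L)) ×
              (∀ L → ¬ (B ∈ L × C ∈ L × D ∈ L)))

module _ (𝓕 : FanoPlane) where
  open FanoPlane 𝓕

  IsAut : (Point ↔ Point) → Set
  IsAut g = ∀ (D : Line) → Σ[ E ∈ Line ] (∀ P → (P ∈ D ⇔ Inverse.to g P ∈ E))

  IsOrientation : (Point ↔ Point) → Set
  IsOrientation τ =
    IsAut τ ×
    (∀ P → iter 7 (Inverse.to τ) P ≡ P) ×
    (∀ k → 1 ≤ k → k < 7 → ¬ (∀ P → iter k (Inverse.to τ) P ≡ P))

  -- sign attached to a residue d mod 7: +1 for 1,2,4 and -1 for 3,5,6
  -- (the value at 0 is never used)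
  residueSign : ℕ → Sign
  residueSign 1 = Sgn.+
  residueSign 2 = Sgn.+
  residueSign 4 = Sgn.+
  residueSign _ = Sgn.-

  IsCanonicalFactor : (Point ↔ Point) → Point → (Point → Point → Sign) → Set
  IsCanonicalFactor τ P₀ ε =
    ∀ (i j : Fin 7) →
      iter (toℕ i) (Inverse.to τ) P₀ ≢ iter (toℕ j) (Inverse.to τ) P₀ →
      ε (iter (toℕ i) (Inverse.to τ) P₀) (iter (toℕ j) (Inverse.to τ) P₀)
        ≡ residueSign ((7 + toℕ j ∸ toℕ i) % 7)

  -- "δ*(g,·) equals the function described by f" (with respect to ε);
  -- f D s means "s is the value of the function at D":
  -- for every line D and distinct P, Q on D, ε_{PQ} ε_{g(P) g(Q)} = f D
  DeltaStarIs : (Point → Point → Sign) → (Point ↔ Point) → (Line → Sign → Set) → Set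
  DeltaStarIs ε g f =
    ∀ (D : Line) (P Q : Point) → P ≢ Q → P ∈ D → Q ∈ D →
      f D (ε P Q · ε (Inverse.to g P) (Inverse.to g Q))

  Const1 : Line → Sign → Set
  Const1 D s = s ≡ Sgn.+

  PointFun : Point → Line → Sign → Set
  PointFun P D s = (P ∈ D → s ≡ Sgn.+) × (¬ (P ∈ D) → s ≡ Sgn.-)

{-# OPTIONS --safe #-}
-- The orbit of P₀ under τ exhausts the seven points, so indexing the points by ℤ/7 turns τ into
-- k ↦ k + 1 and the lines through two orbit points into translates of the index set of the line B₀
-- through P₀ and τ P₀. Distinct translates of B₀ meet in exactly one point, so this index set is a
-- perfect difference set containing 0 and 1, namely {0,1,3} or {0,1,5}. In these coordinates ε^τ is
-- the quadratic residue sign of j − i, and g becomes a collineation of the cyclic model plane, which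
-- is determined by the images of 0, 1 and 2; the theorem is then checked by evaluation on every frame.

module Submission where

open import Defs
open import Data.Bool using (Bool)
open import Data.Bool.Properties using (T-≡)
import Data.Bool.Properties as Bool
open import Data.Fin using (Fin; zero; suc; toℕ; #_)
open import Data.Fin.Properties using (_≟_; all?; any?; injective⇒≤; toℕ-fromℕ<)
open import Data.Fin.Subset using (Subset; inside; outside) renaming (_∈_ to _∈ₛ_)
open import Data.Fin.Subset.Properties using (anySubset?) renaming (_∈?_ to _∈ₛ?_)
open import Data.Nat using (zero; suc; _+_; _*_; _∸_; _%_; _/_; NonZero; s≤s; z≤n) renaming (_≟_ to _≟ℕ_)
open import Data.Nat.DivMod using (_mod_; m≡m%n+[m/n]*n; m%n<n)
open import Data.Nat.Properties using (+-comm; 1+n≰n)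
import Data.Product
open import Data.Product using (Σ; Σ-syntax; ∃; ∃-syntax; _×_; _,_; proj₁; proj₂)
open import Data.Sign using (Sign) renaming (_*_ to _·_)
import Data.Sign as Sign
import Data.Sign.Properties as Sign
open import Data.Sum using (_⊎_; inj₁; inj₂)
import Data.Sum
open import Data.Vec using (_∷_; []; lookup; tabulate)
open import Data.Vec.Properties using (lookup∘tabulate; []=⇒lookup; lookup⇒[]=)
import Data.Vec.Properties as Vec
open import Function using (_∘_; _⇔_; mk⇔; Equivalence; Injective)
open import Function.Bundles using (_↔_; Inverse; Injection)
open import Function.Construct.Composition using (_⇔-∘_)
open import Function.Construct.Identity using (⇔-id)
open import Function.Construct.Symmetry using (↔-sym; ⇔-sym)
open import Function.Properties.Inverse using (↔⇒↣)
open import Relation.Binary.Definitions using (DecidableEquality)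
open import Relation.Binary.PropositionalEquality
  using (_≡_; _≢_; refl; sym; trans; cong; cong₂; subst; _≗_; module ≡-Reasoning)
open import Relation.Unary using (Pred; Decidable)
open import Relation.Nullary using (Dec; yes; no; ¬_; contradiction)
open import Relation.Nullary.Decidable
  using ( _×-dec_; _⊎-dec_; _→-dec_; ¬?; from-yes; decidable-stable; map′; via-injection
        ; ⌊_⌋; toWitness; fromWitness)
import Relation.Nullary.Decidable as Dec
open Equivalence using (to; from)

-- ℤ/7 and its two cyclic Fano planes

_⊕_ : Fin 7 → Fin 7 → Fin 7
i ⊕ j = (toℕ i + toℕ j) mod 7

_⊖_ : Fin 7 → Fin 7 → Fin 7
j ⊖ i = (7 + toℕ j ∸ toℕ i) mod 7

toℕ-⊕ : ∀ i j → toℕ (i ⊕ j) ≡ (toℕ i + toℕ j) % 7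
toℕ-⊕ i j = toℕ-fromℕ< (m%n<n (toℕ i + toℕ j) 7)

toℕ-⊖ : ∀ j i → toℕ (j ⊖ i) ≡ (7 + toℕ j ∸ toℕ i) % 7
toℕ-⊖ j i = toℕ-fromℕ< (m%n<n (7 + toℕ j ∸ toℕ i) 7)

⊕-comm : ∀ i j → i ⊕ j ≡ j ⊕ i
⊕-comm i j = cong (_mod 7) (+-comm (toℕ i) (toℕ j))

-- Facts about ℤ/7 are proved by running a decision procedure. These proofs, and the proofs found
-- by search further down, are opaque so that type checking never re-runs a search by unfolding them.
opaque
  ⊖-⊕-cancel : ∀ k m → (k ⊖ m) ⊕ m ≡ k
  ⊖-⊕-cancel = from-yes (all? λ k → all? λ m → (k ⊖ m) ⊕ m ≟ k)

  ⊖≡zero⇒≡ : ∀ j i → j ⊖ i ≡ zero → j ≡ i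
  ⊖≡zero⇒≡ = from-yes (all? λ j → all? λ i → j ⊖ i ≟ zero →-dec j ≟ i)

  invertible-mod-7 : ∀ (k : Fin 7) → k ≢ zero → ∃ λ (n : Fin 7) → (toℕ n * toℕ k) % 7 ≡ 1
  invertible-mod-7 = from-yes (all? λ (k : Fin 7) → ¬? (k ≟ zero) →-dec
    any? λ (n : Fin 7) → (toℕ n * toℕ k) % 7 ≟ℕ 1)

infix 2 _⇔-dec_
_⇔-dec_ : ∀ {a b} {A : Set a} {B : Set b} → Dec A → Dec B → Dec (A ⇔ B)
a? ⇔-dec b? = map′ (λ (f , g) → mk⇔ f g) (λ A⇔B → to A⇔B , from A⇔B)
                   ((a? →-dec b?) ×-dec (b? →-dec a?))

allSubsets? : ∀ {n ℓ} {P : Pred (Subset n) ℓ} → Decidable P → Dec (∀ S → P S)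
allSubsets? P? with anySubset? (¬? ∘ P?)
... | yes (S , ¬PS) = no λ ∀P → ¬PS (∀P S)
... | no ∄¬P        = yes λ S → decidable-stable (P? S) λ ¬PS → ∄¬P (S , ¬PS)

OccursOnceAsDifference : Subset 7 → Fin 7 → Set
OccursOnceAsDifference S d =
  (∃[ k ] (k ∈ₛ S × k ⊖ d ∈ₛ S)) ×
  (∀ k l → k ∈ₛ S → k ⊖ d ∈ₛ S → l ∈ₛ S → l ⊖ d ∈ₛ S → k ≡ l)

data Block : Set where
  block013 block015 : Block

members : Block → Subset 7
members block013 = inside ∷ inside ∷ outside ∷ inside ∷ outside ∷ outside ∷ outside ∷ []
members block015 = inside ∷ inside ∷ outside ∷ outside ∷ outside ∷ inside ∷ outside ∷ []

allBlocks? : ∀ {ℓ} {P : Block → Set ℓ} → (∀ B → Dec (P B)) → Dec (∀ B → P B)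
allBlocks? P? = map′ (λ { (p₁ , p₂) block013 → p₁ ; (p₁ , p₂) block015 → p₂ })
                     (λ ∀P → ∀P block013 , ∀P block015)
                     (P? block013 ×-dec P? block015)

anyBlock? : ∀ {ℓ} {P : Block → Set ℓ} → (∀ B → Dec (P B)) → Dec (∃ P)
anyBlock? P? = map′ (λ { (inj₁ p) → block013 , p ; (inj₂ p) → block015 , p })
                    (λ { (block013 , p) → inj₁ p ; (block015 , p) → inj₂ p })
                    (P? block013 ⊎-dec P? block015)

opaque
  perfect-difference-set : ∀ S → zero ∈ₛ S → # 1 ∈ₛ S →
                           (∀ d → d ≢ zero → OccursOnceAsDifference S d) → ∃[ B ] S ≡ members B
  perfect-difference-set = from-yes (allSubsets? λ (S : Subset 7) →
    zero ∈ₛ? S →-dec # 1 ∈ₛ? S →-dec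
    (all? λ d → ¬? (d ≟ zero) →-dec
       ((any? λ k → k ∈ₛ? S ×-dec k ⊖ d ∈ₛ? S) ×-dec
        (all? λ k → all? λ l →
           k ∈ₛ? S →-dec k ⊖ d ∈ₛ? S →-dec l ∈ₛ? S →-dec l ⊖ d ∈ₛ? S →-dec k ≟ l)))
    →-dec anyBlock? λ B → Vec.≡-dec Bool._≟_ S (members B))

-- apex B d is the third point on the line through 0 and d; apex B zero is junk
apex : Block → Fin 7 → Fin 7
apex block013 = lookup (# 0 ∷ # 3 ∷ # 6 ∷ # 1 ∷ # 5 ∷ # 4 ∷ # 2 ∷ [])
apex block015 = lookup (# 0 ∷ # 5 ∷ # 3 ∷ # 2 ∷ # 6 ∷ # 1 ∷ # 4 ∷ [])

third : Block → Fin 7 → Fin 7 → Fin 7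
third B i j = i ⊕ apex B (j ⊖ i)

OnLineThrough : Block → Fin 7 → Fin 7 → Fin 7 → Set
OnLineThrough B i j r = r ≡ i ⊎ r ≡ j ⊎ r ≡ third B i j

onLineThrough? : ∀ B i j r → Dec (OnLineThrough B i j r)
onLineThrough? B i j r = r ≟ i ⊎-dec r ≟ j ⊎-dec r ≟ third B i j

opaque
  line-through : ∀ B i j → ∃[ m ] (i ⊖ m ∈ₛ members B × j ⊖ m ∈ₛ members B)
  line-through = from-yes (allBlocks? λ B → all? λ i → all? λ j →
    any? λ m → i ⊖ m ∈ₛ? members B ×-dec j ⊖ m ∈ₛ? members B)

opaque
  points-of-translate : ∀ B m {i j} → i ≢ j → i ⊖ m ∈ₛ members B → j ⊖ m ∈ₛ members B →
                        ∀ r →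
                        r ⊖ m ∈ₛ members B ⇔ OnLineThrough B i j r
  points-of-translate B m {i} {j} = from-yes (allBlocks? λ B → all? λ m → all? λ i → all? λ j →
    ¬? (i ≟ j) →-dec i ⊖ m ∈ₛ? members B →-dec j ⊖ m ∈ₛ? members B →-dec
    all? λ r → r ⊖ m ∈ₛ? members B ⇔-dec onLineThrough? B i j r) B m i j

opaque
  third-distinct : ∀ B i j → i ≢ j → third B i j ≢ i × third B i j ≢ j
  third-distinct = from-yes (allBlocks? λ B → all? λ i → all? λ j →
    ¬? (i ≟ j) →-dec ¬? (third B i j ≟ i) ×-dec ¬? (third B i j ≟ j))

IsCollineation : Block → (Fin 7 → Fin 7) → Set
IsCollineation B π = Injective _≡_ _≡_ π × (∀ {i j} → i ≢ j → π (third B i j) ≡ third B (π i) (π j))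

-- The line through k and k + 3 is {k, k + 1, k + 3} for block013 and {k, k + 2, k + 3} for block015,
-- so next B x₀ x₁ x₂ computes the image of k + 3 from the images of k, k + 1, k + 2.
next : Block → Fin 7 → Fin 7 → Fin 7 → Fin 7
next block013 x y z = third block013 x y
next block015 x y z = third block015 x z

extend : Block → Fin 7 → Fin 7 → Fin 7 → Fin 7 → Fin 7
extend B x₀ x₁ x₂ = lookup (x₀ ∷ x₁ ∷ x₂ ∷ x₃ ∷ x₄ ∷ x₅ ∷ x₆ ∷ [])
  where
  x₃ = next B x₀ x₁ x₂
  x₄ = next B x₁ x₂ x₃
  x₅ = next B x₂ x₃ x₄
  x₆ = next B x₃ x₄ x₅

next-frame : ∀ B → next B (# 0) (# 1) (# 2) ≡ # 3 × next B (# 1) (# 2) (# 3) ≡ # 4 ×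
                   next B (# 2) (# 3) (# 4) ≡ # 5 × next B (# 3) (# 4) (# 5) ≡ # 6
next-frame block013 = refl , refl , refl , refl
next-frame block015 = refl , refl , refl , refl

next-preserved : ∀ {B π x y z} → IsCollineation B π → x ≢ y → x ≢ z →
                 π (next B x y z) ≡ next B (π x) (π y) (π z)
next-preserved {block013} (_ , third-preserved) x≢y x≢z = third-preserved x≢y
next-preserved {block015} (_ , third-preserved) x≢y x≢z = third-preserved x≢z

collineation-determined : ∀ {B π} → IsCollineation B π → π ≗ extend B (π (# 0)) (π (# 1)) (π (# 2))
collineation-determined {B} {π} col = determined
  where
  step : ∀ {x y z w} → next B x y z ≡ w → x ≢ y → x ≢ z → π w ≡ next B (π x) (π y) (π z)
  step refl = next-preserved {B} col

  next-cong : ∀ {x x′ y y′ z z′} → x ≡ x′ → y ≡ y′ → z ≡ z′ →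
              next B x y z ≡ next B x′ y′ z′
  next-cong refl refl refl = refl

  x = extend B (π (# 0)) (π (# 1)) (π (# 2))

  π₃ : π (# 3) ≡ x (# 3)
  π₃ = step (proj₁ (next-frame B)) (λ ()) (λ ())
  π₄ : π (# 4) ≡ x (# 4)
  π₄ = trans (step (proj₁ (proj₂ (next-frame B))) (λ ()) (λ ())) (next-cong refl refl π₃)
  π₅ : π (# 5) ≡ x (# 5)
  π₅ = trans (step (proj₁ (proj₂ (proj₂ (next-frame B)))) (λ ()) (λ ())) (next-cong refl π₃ π₄)
  π₆ : π (# 6) ≡ x (# 6)
  π₆ = trans (step (proj₂ (proj₂ (proj₂ (next-frame B)))) (λ ()) (λ ())) (next-cong π₃ π₄ π₅)

  determined : π ≗ x
  determined zero = refl
  determined (suc zero) = refl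
  determined (suc (suc zero)) = refl
  determined (suc (suc (suc zero))) = π₃
  determined (suc (suc (suc (suc zero)))) = π₄
  determined (suc (suc (suc (suc (suc zero))))) = π₅
  determined (suc (suc (suc (suc (suc (suc zero)))))) = π₆

-- Sign patterns of collineations of the model planes

module _ (𝓕 : FanoPlane) where

  -- residueSign is declared relative to a plane, but does not depend on it
  sign : Fin 7 → Fin 7 → Sign
  sign i j = residueSign 𝓕 (toℕ (j ⊖ i))

  δ : (Fin 7 → Fin 7) → Fin 7 → Fin 7 → Sign
  δ π i j = sign i j · sign (π i) (π j)

  IsConstantOne : (Fin 7 → Fin 7) → Set
  IsConstantOne π = ∀ i j → i ≢ j → δ π i j ≡ Sign.+

  IsPointFunction : Block → (Fin 7 → Fin 7) → Fin 7 → Set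
  IsPointFunction B π r = ∀ i j → i ≢ j →
    (OnLineThrough B i j r → δ π i j ≡ Sign.+) × (¬ OnLineThrough B i j r → δ π i j ≡ Sign.-)

  Classified : Block → (Fin 7 → Fin 7) → Set
  Classified B π = IsConstantOne π ⊎ ∃ (IsPointFunction B π)

  classified? : ∀ B π → Dec (Classified B π)
  classified? B π =
    (all? λ i → all? λ j → ¬? (i ≟ j) →-dec δ π i j Sign.≟ Sign.+) ⊎-dec
    (any? λ r → all? λ i → all? λ j → ¬? (i ≟ j) →-dec
       (onLineThrough? B i j r →-dec δ π i j Sign.≟ Sign.+) ×-dec
       (¬? (onLineThrough? B i j r) →-dec δ π i j Sign.≟ Sign.-))

  opaque
    frame-classification : ∀ B a b c → (∀ i j → extend B a b c i ≡ extend B a b c j → i ≡ j) →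
                           Classified B (extend B a b c)
    frame-classification = from-yes (allBlocks? λ B → all? λ a → all? λ b → all? λ c →
      (all? λ i → all? λ j → extend B a b c i ≟ extend B a b c j →-dec i ≟ j) →-dec
      classified? B (extend B a b c))

  classified-resp-≗ : ∀ {B π π′} → π ≗ π′ → Classified B π → Classified B π′
  classified-resp-≗ {B} {π} {π′} π≗π′ = Data.Sum.map
      (λ const i j i≢j → trans (sym (δ-resp i j)) (const i j i≢j))
      (λ (r , point) → r , λ i j i≢j → Data.Product.map
         (λ on → trans (sym (δ-resp i j)) ∘ on) (λ off → trans (sym (δ-resp i j)) ∘ off) (point i j i≢j))
    where
    δ-resp : ∀ i j → δ π i j ≡ δ π′ i j
    δ-resp i j = cong₂ (λ x y → sign i j · sign x y) (π≗π′ i) (π≗π′ j)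

  collineation-classification : ∀ {B π} → IsCollineation B π → Classified B π
  collineation-classification {B} {π} col =
    classified-resp-≗ {B} (λ i → sym (collineation-determined {B} col i))
      (frame-classification B _ _ _ λ i j e →
        proj₁ col (trans (collineation-determined {B} col i) (trans e (sym (collineation-determined {B} col j)))))

-- Iterates of a permutation of order 7

iter-preserves : ∀ {A : Set} (f : A → A) (P : A → Set) → (∀ x → P x → P (f x)) →
                 ∀ n x → P x → P (iter n f x)
iter-preserves f P step zero    x Px = Px
iter-preserves f P step (suc n) x Px = step _ (iter-preserves f P step n x Px)

module _ {A : Set} (f : A → A) where

  iter-+ : ∀ m n x → iter (m + n) f x ≡ iter m f (iter n f x)
  iter-+ zero    n x = refl
  iter-+ (suc m) n x = cong f (iter-+ m n x)

  iter-* : ∀ m n x → iter m (iter n f) x ≡ iter (m * n) f x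
  iter-* zero    n x = refl
  iter-* (suc m) n x = trans (cong (iter n f) (iter-* m n x)) (sym (iter-+ n (m * n) x))

  iter-commute : ∀ n x → iter n f (f x) ≡ f (iter n f x)
  iter-commute zero    x = refl
  iter-commute (suc n) x = cong f (iter-commute n x)

  iter-injective : Injective _≡_ _≡_ f → ∀ n → Injective _≡_ _≡_ (iter n f)
  iter-injective f-inj zero    e = e
  iter-injective f-inj (suc n) e = iter-injective f-inj n (f-inj e)

  iter-mod : ∀ k .{{_ : NonZero k}} → (∀ x → iter k f x ≡ x) → ∀ n x → iter n f x ≡ iter (n % k) f x
  iter-mod k period n x = begin
    iter n f x                           ≡⟨ cong (λ m → iter m f x) (m≡m%n+[m/n]*n n k) ⟩
    iter (n % k + n / k * k) f x         ≡⟨ iter-+ (n % k) (n / k * k) x ⟩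
    iter (n % k) f (iter (n / k * k) f x) ≡⟨ cong (iter (n % k) f) full-turns ⟩
    iter (n % k) f x                     ∎
    where
    open ≡-Reasoning
    full-turns : iter (n / k * k) f x ≡ x
    full-turns = trans (sym (iter-* (n / k) k x))
                       (iter-preserves (iter k f) (_≡ x) (λ y y≡x → trans (period y) y≡x) (n / k) x refl)

Fin-injective⇒surjective : ∀ {n} {f : Fin n → Fin n} → Injective _≡_ _≡_ f → ∀ y → ∃[ x ] f x ≡ y
Fin-injective⇒surjective {n} {f} f-inj y with any? (λ x → f x ≟ y)
... | yes found = found
... | no ∄x = contradiction (injective⇒≤ g-inj) 1+n≰n
  where
  g : Fin (suc n) → Fin n
  g zero    = y
  g (suc x) = f x

  g-inj : Injective _≡_ _≡_ g
  g-inj {zero}  {zero}   _ = refl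
  g-inj {zero}  {suc x}  e = contradiction (x , sym e) ∄x
  g-inj {suc x} {zero}   e = contradiction (x , e) ∄x
  g-inj {suc x} {suc x′} e = cong suc (f-inj e)

module PermutationOfOrder7 {A : Set} (index : Fin 7 ↔ A) (σ : A → A) (σ-injective : Injective _≡_ _≡_ σ)
              (period : ∀ x → iter 7 σ x ≡ x) where

  _≟ᴬ_ : DecidableEquality A
  _≟ᴬ_ = via-injection (↔⇒↣ (↔-sym index)) _≟_

  orbit : A → Fin 7 → A
  orbit x i = iter (toℕ i) σ x

  orbit-shift : ∀ m i x → iter (toℕ m) σ (orbit x i) ≡ orbit x (m ⊕ i)
  orbit-shift m i x = begin
    iter (toℕ m) σ (iter (toℕ i) σ x)  ≡⟨ iter-+ σ (toℕ m) (toℕ i) x ⟨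
    iter (toℕ m + toℕ i) σ x           ≡⟨ iter-mod σ 7 period (toℕ m + toℕ i) x ⟩
    iter ((toℕ m + toℕ i) % 7) σ x     ≡⟨ cong (λ n → iter n σ x) (toℕ-⊕ m i) ⟨
    orbit x (m ⊕ i)                    ∎
    where open ≡-Reasoning

  -- 7 is prime, so σ is itself a power of σ^k
  preserved-by-power⇒preserved : ∀ (P : A → Set) k → k ≢ zero →
                                 (∀ x → P x → P (iter (toℕ k) σ x)) → ∀ x → P x → P (σ x)
  preserved-by-power⇒preserved P k k≢0 closed x Px with invertible-mod-7 k k≢0
  ... | n , nk≡1 = subst P σ-as-power (iter-preserves (iter (toℕ k) σ) P closed (toℕ n) x Px)
    where
    σ-as-power : iter (toℕ n) (iter (toℕ k) σ) x ≡ σ x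
    σ-as-power = trans (iter-* σ (toℕ n) (toℕ k) x)
                       (trans (iter-mod σ 7 period (toℕ n * toℕ k) x) (cong (λ m → iter m σ x) nk≡1))

  fixed-by-power⇒fixed : ∀ {x} k → k ≢ zero → iter (toℕ k) σ x ≡ x → σ x ≡ x
  fixed-by-power⇒fixed {x} k k≢0 fixed =
    preserved-by-power⇒preserved (_≡ x) k k≢0 (λ y y≡x → trans (cong (iter (toℕ k) σ) y≡x) fixed) x refl

  moved⇒orbit-injective : ∀ {x} → σ x ≢ x → Injective _≡_ _≡_ (orbit x)
  moved⇒orbit-injective {x} moved {i} {j} xᵢ≡xⱼ with j ≟ i
  ... | yes j≡i = sym j≡i
  ... | no  j≢i = contradiction σx≡x moved
    where
    xᵢ-fixed : iter (toℕ (j ⊖ i)) σ (orbit x i) ≡ orbit x i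
    xᵢ-fixed = trans (orbit-shift (j ⊖ i) i x) (trans (cong (orbit x) (⊖-⊕-cancel j i)) (sym xᵢ≡xⱼ))

    σx≡x : σ x ≡ x
    σx≡x = iter-injective σ σ-injective (toℕ i)
             (trans (iter-commute σ (toℕ i) x)
                    (fixed-by-power⇒fixed (j ⊖ i) (j≢i ∘ ⊖≡zero⇒≡ j i) xᵢ-fixed))

  index⁻¹-injective : Injective _≡_ _≡_ (Inverse.from index)
  index⁻¹-injective = Injection.injective (↔⇒↣ (↔-sym index))

  injective-orbit-surjective : ∀ {x} → Injective _≡_ _≡_ (orbit x) → ∀ y → ∃[ i ] orbit x i ≡ y
  injective-orbit-surjective {x} orbit-inj y
    with i , e ← Fin-injective⇒surjective (orbit-inj ∘ index⁻¹-injective) (Inverse.from index y)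
    = i , index⁻¹-injective e

  fixed-point⇒identity : ∀ {x} → σ x ≡ x → ∀ y → σ y ≡ y
  fixed-point⇒identity {x} σx≡x y with σ y ≟ᴬ y
  ... | yes σy≡y = σy≡y
  ... | no  moved with i , yᵢ≡x ← injective-orbit-surjective (moved⇒orbit-injective moved) x
    = iter-injective σ σ-injective (toℕ i)
        (trans (iter-commute σ (toℕ i) y) (trans (cong σ yᵢ≡x) (trans σx≡x (sym yᵢ≡x))))

-- An oriented Fano plane in ℤ/7 coordinates

module OrientedFanoPlane (𝓕 : FanoPlane) (τ : FanoPlane.Point 𝓕 ↔ FanoPlane.Point 𝓕)
                         (orientation : IsOrientation 𝓕 τ) (P₀ : FanoPlane.Point 𝓕) where
  open FanoPlane 𝓕

  σ : Point → Point
  σ = Inverse.to τ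

  open PermutationOfOrder7 points σ (Injection.injective (↔⇒↣ τ)) (proj₁ (proj₂ orientation))

  _≟ₗ_ : DecidableEquality Line
  _≟ₗ_ = via-injection (↔⇒↣ (↔-sym lines)) _≟_

  line-unique : ∀ {P Q D E} → P ≢ Q → P ∈ D → Q ∈ D → P ∈ E → Q ∈ E → D ≡ E
  line-unique P≢Q P∈D Q∈D P∈E Q∈E with _ , _ , _ , unique ← join _ _ P≢Q
    = trans (unique _ P∈D Q∈D) (sym (unique _ P∈E Q∈E))

  no-line-contains-all : ∀ D → ¬ (∀ X → X ∈ D)
  no-line-contains-all D all-on-D with A , B , C , _ , _ , _ , _ , _ , _ , _ , ABC-not-collinear , _ ← nondeg
    = ABC-not-collinear D (all-on-D A , all-on-D B , all-on-D C)

  ∈-decidable : ∀ {P D} → P ∈ D → ∀ X → Dec (X ∈ D)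
  ∈-decidable {P} {D} P∈D X with X ≟ᴬ P
  ... | yes refl = yes P∈D
  ... | no  X≢P  = Dec.map (mk⇔ (λ L≡D → subst (X ∈_) L≡D (proj₁ (proj₂ (proj₂ PX))))
                                (λ X∈D → sym (proj₂ (proj₂ (proj₂ PX)) D P∈D X∈D)))
                           (proj₁ PX ≟ₗ D)
    where
    PX = join P X (X≢P ∘ sym)

  p : Fin 7 → Point
  p = orbit P₀

  p-injective : Injective _≡_ _≡_ p
  p-injective with σ P₀ ≟ᴬ P₀
  ... | no  moved = moved⇒orbit-injective moved
  ... | yes fixed = contradiction (fixed-point⇒identity fixed)
                                  (proj₂ (proj₂ orientation) 1 (s≤s z≤n) (s≤s (s≤s z≤n)))

  opaque
    p-surjective : ∀ X → ∃[ i ] p i ≡ X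
    p-surjective = injective-orbit-surjective p-injective

  σᴸ : Line → Line
  σᴸ D = proj₁ (proj₁ orientation D)

  translate : Fin 7 → Line → Line
  translate m = iter (toℕ m) σᴸ

  ∈-iter : ∀ n {X D} → X ∈ D ⇔ iter n σ X ∈ iter n σᴸ D
  ∈-iter zero    = ⇔-id _
  ∈-iter (suc n) {X} {D} = proj₂ (proj₁ orientation (iter n σᴸ D)) (iter n σ X) ⇔-∘ ∈-iter n

  B₀ : Line
  B₀ = proj₁ (join (p (# 0)) (p (# 1)) λ p₀≡p₁ → 0≢1 (p-injective p₀≡p₁))
    where
    0≢1 : # 0 ≢ # 1
    0≢1 ()

  p₀∈B₀ : p (# 0) ∈ B₀
  p₀∈B₀ = proj₁ (proj₂ (join (p (# 0)) (p (# 1)) _))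

  p₁∈B₀ : p (# 1) ∈ B₀
  p₁∈B₀ = proj₁ (proj₂ (proj₂ (join (p (# 0)) (p (# 1)) _)))

  on-B₀ : Fin 7 → Bool
  on-B₀ k = ⌊ ∈-decidable p₀∈B₀ (p k) ⌋

  S : Subset 7
  S = tabulate on-B₀

  p∈B₀⇔∈S : ∀ k → p k ∈ B₀ ⇔ k ∈ₛ S
  p∈B₀⇔∈S k = mk⇔
    (λ pₖ∈B₀ → lookup⇒[]= k S (trans (lookup∘tabulate on-B₀ k) (to T-≡ (fromWitness pₖ∈B₀))))
    (λ k∈S → toWitness {a? = ∈-decidable p₀∈B₀ (p k)}
                       (from T-≡ (trans (sym (lookup∘tabulate on-B₀ k)) ([]=⇒lookup k∈S))))

  p-shift : ∀ k m → iter (toℕ m) σ (p (k ⊖ m)) ≡ p k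
  p-shift k m = trans (orbit-shift m (k ⊖ m) P₀) (cong p (trans (⊕-comm m (k ⊖ m)) (⊖-⊕-cancel k m)))

  p∈translate⇔∈S : ∀ k m → p k ∈ translate m B₀ ⇔ k ⊖ m ∈ₛ S
  p∈translate⇔∈S k m = subst (λ X → X ∈ translate m B₀ ⇔ k ⊖ m ∈ₛ S) (p-shift k m)
                              (p∈B₀⇔∈S (k ⊖ m) ⇔-∘ ⇔-sym (∈-iter (toℕ m)))

  translate-fixed⇒zero : ∀ d → translate d B₀ ≡ B₀ → d ≡ zero
  translate-fixed⇒zero d fixed with d ≟ zero
  ... | yes d≡0 = d≡0
  ... | no  d≢0 = contradiction all-on-B₀ (no-line-contains-all B₀)
    where
    σ-closed : ∀ X → X ∈ B₀ → σ X ∈ B₀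
    σ-closed = preserved-by-power⇒preserved (_∈ B₀) d d≢0
                 λ X X∈B₀ → subst (iter (toℕ d) σ X ∈_) fixed (to (∈-iter (toℕ d)) X∈B₀)

    all-on-B₀ : ∀ X → X ∈ B₀
    all-on-B₀ X with i , refl ← p-surjective X = iter-preserves σ (_∈ B₀) σ-closed (toℕ i) P₀ p₀∈B₀

  -- B₀ and its translate by d are distinct lines, so they meet in exactly one point
  occurs-once : ∀ d → d ≢ zero → OccursOnceAsDifference S d
  occurs-once d d≢0 = common-point , at-most-one
    where
    moved : translate d B₀ ≢ B₀
    moved = d≢0 ∘ translate-fixed⇒zero d

    common-point : ∃[ k ] (k ∈ₛ S × k ⊖ d ∈ₛ S)
    common-point with X , X∈B₀ , X∈dB₀ , _ ← meet B₀ (translate d B₀) (moved ∘ sym)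
                 with k , refl ← p-surjective X
      = k , to (p∈B₀⇔∈S k) X∈B₀ , to (p∈translate⇔∈S k d) X∈dB₀

    at-most-one : ∀ k l → k ∈ₛ S → k ⊖ d ∈ₛ S → l ∈ₛ S → l ⊖ d ∈ₛ S → k ≡ l
    at-most-one k l k∈S k∈dS l∈S l∈dS with k ≟ l
    ... | yes k≡l = k≡l
    ... | no  k≢l = contradiction
      (line-unique (k≢l ∘ p-injective)
                   (from (p∈translate⇔∈S k d) k∈dS) (from (p∈translate⇔∈S l d) l∈dS)
                   (from (p∈B₀⇔∈S k) k∈S) (from (p∈B₀⇔∈S l) l∈S))
      moved

  opaque
    base-block : ∃[ B ] S ≡ members B
    base-block =
      perfect-difference-set S (to (p∈B₀⇔∈S _) p₀∈B₀) (to (p∈B₀⇔∈S _) p₁∈B₀) occurs-once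

  B : Block
  B = proj₁ base-block

  p∈translate⇔ : ∀ k m → p k ∈ translate m B₀ ⇔ k ⊖ m ∈ₛ members B
  p∈translate⇔ k m =
    subst (λ T → p k ∈ translate m B₀ ⇔ k ⊖ m ∈ₛ T) (proj₂ base-block) (p∈translate⇔∈S k m)

  points-on-line : ∀ {i j D} → i ≢ j → p i ∈ D → p j ∈ D → ∀ r → p r ∈ D ⇔ OnLineThrough B i j r
  points-on-line {i} {j} {D} i≢j pᵢ∈D pⱼ∈D r with m , i∈m , j∈m ← line-through B i j
    = subst (λ L → p r ∈ L ⇔ OnLineThrough B i j r) translate≡D
            (points-of-translate B m i≢j i∈m j∈m r ⇔-∘ p∈translate⇔ r m)
    where
    translate≡D : translate m B₀ ≡ D
    translate≡D = line-unique (i≢j ∘ p-injective)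
                              (from (p∈translate⇔ i m) i∈m) (from (p∈translate⇔ j m) j∈m) pᵢ∈D pⱼ∈D

  module Automorphism (g : Point ↔ Point) (g-aut : IsAut 𝓕 g) where

    π : Fin 7 → Fin 7
    π i = proj₁ (p-surjective (Inverse.to g (p i)))

    p∘π : ∀ i → p (π i) ≡ Inverse.to g (p i)
    p∘π i = proj₂ (p-surjective (Inverse.to g (p i)))

    π-injective : Injective _≡_ _≡_ π
    π-injective {i} {j} πᵢ≡πⱼ =
      p-injective (Injection.injective (↔⇒↣ g) (trans (sym (p∘π i)) (trans (cong p πᵢ≡πⱼ) (p∘π j))))

    image-of-line : ∀ D i → p i ∈ D → p (π i) ∈ proj₁ (g-aut D)
    image-of-line D i pᵢ∈D = subst (_∈ proj₁ (g-aut D)) (sym (p∘π i)) (to (proj₂ (g-aut D) (p i)) pᵢ∈D)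

    π-preserves-lines : ∀ {i j r} → i ≢ j → OnLineThrough B i j r → OnLineThrough B (π i) (π j) (π r)
    π-preserves-lines {i} {j} {r} i≢j r-on-ij =
      to (points-on-line (i≢j ∘ π-injective) (image-of-line D i pᵢ∈D) (image-of-line D j pⱼ∈D) (π r))
         (image-of-line D r (from (points-on-line i≢j pᵢ∈D pⱼ∈D r) r-on-ij))
      where
      ij = join (p i) (p j) (i≢j ∘ p-injective)
      D = proj₁ ij
      pᵢ∈D = proj₁ (proj₂ ij)
      pⱼ∈D = proj₁ (proj₂ (proj₂ ij))

    π-collineation : IsCollineation B π
    π-collineation = π-injective , third-preserved
      where
      third-preserved : ∀ {i j} → i ≢ j → π (third B i j) ≡ third B (π i) (π j)
      third-preserved {i} {j} i≢j with π-preserves-lines i≢j (inj₂ (inj₂ refl))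
      ... | inj₁ πₜ≡πᵢ           = contradiction (π-injective πₜ≡πᵢ) (proj₁ (third-distinct B i j i≢j))
      ... | inj₂ (inj₁ πₜ≡πⱼ)    = contradiction (π-injective πₜ≡πⱼ) (proj₂ (third-distinct B i j i≢j))
      ... | inj₂ (inj₂ πₜ≡third) = πₜ≡third

    module _ (ε : Point → Point → Sign) (canonical : IsCanonicalFactor 𝓕 τ P₀ ε) where

      ε-on-orbit : ∀ {i j} → i ≢ j → ε (p i) (p j) ≡ sign 𝓕 i j
      ε-on-orbit {i} {j} i≢j =
        trans (canonical i j (i≢j ∘ p-injective)) (cong (residueSign 𝓕) (sym (toℕ-⊖ j i)))

      δ*-on-orbit : ∀ {i j} → i ≢ j →
                    ε (p i) (p j) · ε (Inverse.to g (p i)) (Inverse.to g (p j)) ≡ δ 𝓕 π i j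
      δ*-on-orbit {i} {j} i≢j =
        cong₂ _·_ (ε-on-orbit i≢j)
                  (trans (cong₂ ε (sym (p∘π i)) (sym (p∘π j))) (ε-on-orbit (i≢j ∘ π-injective)))

      δ*-from-orbit : ∀ {f} → (∀ {D i j} → i ≢ j → p i ∈ D → p j ∈ D → f D (δ 𝓕 π i j)) →
                      DeltaStarIs 𝓕 ε g f
      δ*-from-orbit {f} h D P Q P≢Q P∈D Q∈D
        with i , refl ← p-surjective P | j , refl ← p-surjective Q
        = subst (f D) (sym (δ*-on-orbit i≢j)) (h i≢j P∈D Q∈D)
        where
        i≢j : i ≢ j
        i≢j = P≢Q ∘ cong p

      constant-one : IsConstantOne 𝓕 π → DeltaStarIs 𝓕 ε g (Const1 𝓕)
      constant-one const = δ*-from-orbit {Const1 𝓕} λ {_} {i} {j} i≢j _ _ → const i j i≢j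

      point-function : ∀ {r} → IsPointFunction 𝓕 B π r → DeltaStarIs 𝓕 ε g (PointFun 𝓕 (p r))
      point-function {r} point = δ*-from-orbit {PointFun 𝓕 (p r)} λ {_} {i} {j} i≢j pᵢ∈D pⱼ∈D →
        (λ pᵣ∈D → proj₁ (point i j i≢j) (to (points-on-line i≢j pᵢ∈D pⱼ∈D r) pᵣ∈D)) ,
        (λ pᵣ∉D → proj₂ (point i j i≢j) (pᵣ∉D ∘ from (points-on-line i≢j pᵢ∈D pⱼ∈D r)))

theorem2p31 : (𝓕 : FanoPlane) (τ : FanoPlane.Point 𝓕 ↔ FanoPlane.Point 𝓕)
    → IsOrientation 𝓕 τ
    → (P₀ : FanoPlane.Point 𝓕)
    → (ε : FanoPlane.Point 𝓕 → FanoPlane.Point 𝓕 → Sign)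
    → IsCanonicalFactor 𝓕 τ P₀ ε
    → (g : FanoPlane.Point 𝓕 ↔ FanoPlane.Point 𝓕)
    → IsAut 𝓕 g
    → DeltaStarIs 𝓕 ε g (Const1 𝓕)
      ⊎ Σ[ P ∈ FanoPlane.Point 𝓕 ] DeltaStarIs 𝓕 ε g (PointFun 𝓕 P)
theorem2p31 𝓕 τ orientation P₀ ε canonical g g-aut =
  Data.Sum.map (constant-one ε canonical) (λ (r , point) → p r , point-function ε canonical point)
               (collineation-classification 𝓕 {B} π-collineation)
  where
  open OrientedFanoPlane 𝓕 τ orientation P₀
  open Automorphism g g-aut
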